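{- Let $G=(V,E)$ be a graph and $k$ an integer. Let $\varphi_G$ be the CNF formula over the variable set $\{x_v : v\in V\}$ given by the conjunction of the clauses $\neg x_u\lor\neg x_v$ over all edges $\{u,v\}\in E$. Then $G$ has an induced bipartite subgraph with at least $k$ vertices if and only if $\varphi_G$ has two satisfying assignments $\alpha_1,\alpha_2$ with $|\alpha_1\triangle\alpha_2|\ge k$.
   Context: For truth assignments $\alpha_1,\alpha_2$ on a variable set $X$, $\alpha_1\triangle\alpha_2=\{x\in X:\alpha_1(x)\neq\alpha_2(x)\}$. -}

module Defs where

open import Data.Nat using (ℕ)
open import Data.Bool using (Bool; true; false; not; _xor_; T)
open import Data.Fin using (Fin)
open import Data.Fin.Subset using (Subset; _∈_; ∣_∣)
open import Data.List using (List; []; _∷_; concatMap; allFin; map)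
open import Data.List.Relation.Unary.All using (All)
open import Data.List.Relation.Unary.Any using (Any)
open import Data.Vec using (tabulate)
open import Data.Product using (_×_; Σ; ∃)
open import Relation.Binary.PropositionalEquality using (_≡_; _≢_)

record Graph (n : ℕ) : Set where
  field
    adj   : Fin n → Fin n → Bool
    sym   : ∀ u v → adj u v ≡ adj v u
    irrefl : ∀ v → adj v v ≡ false
open Graph public

Assignment : ℕ → Set
Assignment n = Fin n → Bool

data Literal (n : ℕ) : Set where
  pos : Fin n → Literal n
  neg : Fin n → Literal n

Clause : ℕ → Set
Clause n = List (Literal n)

CNF : ℕ → Set
CNF n = List (Clause n)

litVal : ∀ {n} → Assignment n → Literal n → Bool
litVal α (pos x) = α x
litVal α (neg x) = not (α x)

SatClause : ∀ {n} → Assignment n → Clause n → Set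
SatClause α C = Any (λ l → T (litVal α l)) C

Satisfies : ∀ {n} → Assignment n → CNF n → Set
Satisfies α φ = All (SatClause α) φ

-- φ_G : the conjunction of clauses (¬x_u ∨ ¬x_v) over all edges {u,v}.
-- (Each edge appears for both orientations; duplicate clauses do not
-- change the formula's semantics.)
edgeClauses : ∀ {n} → Graph n → Fin n → Fin n → List (Clause n)
edgeClauses G u v with adj G u v
... | true  = (neg u ∷ neg v ∷ []) ∷ []
... | false = []

φ : ∀ {n} → Graph n → CNF n
φ {n} G = concatMap (λ u → concatMap (λ v → edgeClauses G u v) (allFin n)) (allFin n)

_△_ : ∀ {n} → Assignment n → Assignment n → Subset n
α₁ △ α₂ = tabulate (λ x → α₁ x xor α₂ x)

InducedBipartite : ∀ {n} → Graph n → Subset n → Set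
InducedBipartite {n} G S =
  Σ (Fin n → Bool) λ c →
    ∀ u v → u ∈ S → v ∈ S → adj G u v ≡ true → c u ≢ c v

{-# OPTIONS --safe #-}
-- A satisfying assignment of φ_G is exactly an independent set of G. Given two
-- independent sets, their symmetric difference S is bipartite with colouring
-- α₁: an edge inside S with α₁ constant on it would lie inside α₁ or inside α₂.
-- Conversely the two colour classes of a bipartite S are independent sets whose
-- symmetric difference is S.
module Submission where

open import Defs
open import Data.Nat using (ℕ)
open import Data.Integer using (ℤ; +_; _≤_)
open import Data.Fin using (Fin)
open import Data.Fin.Subset using (Subset; _∈_; ∣_∣)
open import Data.Bool using (Bool; true; false; not; _∧_; _xor_; T)
open import Data.Bool.Properties using (not-injective; T-not-≡; ∧-conicalˡ; ∧-conicalʳ)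
open import Data.Empty using (⊥; ⊥-elim)
open import Data.Product using (Σ; Σ-syntax; _×_; _,_)
open import Data.List using (List; []; _∷_; concatMap; allFin)
open import Data.List.Relation.Unary.All using (All; []; _∷_)
open import Data.List.Relation.Unary.All.Properties
  using (concat⁺; concat⁻; map⁺; map⁻; tabulate⁺; tabulate⁻)
open import Data.List.Relation.Unary.Any using (here; there)
open import Data.Vec using (lookup)
open import Data.Vec.Properties
  using (tabulate-cong; tabulate∘lookup; lookup∘tabulate; []=⇒lookup; lookup⇒[]=)
open import Function.Base using (_∘_)
open import Function.Bundles using (_⇔_; mk⇔; Equivalence)
open import Relation.Binary.PropositionalEquality
  using (_≡_; _≢_; refl; trans; subst)
  renaming (sym to ≡-sym)

private
  variable
    n : ℕ

module _ {B : Set} {P : B → Set} {f : Fin n → List B} where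

  All-concatMap-allFin⁺ : (∀ i → All P (f i)) → All P (concatMap f (allFin n))
  All-concatMap-allFin⁺ = concat⁺ ∘ map⁺ ∘ tabulate⁺

  All-concatMap-allFin⁻ : All P (concatMap f (allFin n)) → ∀ i → All P (f i)
  All-concatMap-allFin⁻ = tabulate⁻ ∘ map⁻ ∘ concat⁻

IsIndependent : Graph n → Assignment n → Set
IsIndependent G α = ∀ u v → adj G u v ≡ true → α u ≡ true → α v ≡ true → ⊥

module _ {α : Assignment n} {u v : Fin n} where

  SatClause-negPair⁺ : (α u ≡ true → α v ≡ true → ⊥) → SatClause α (neg u ∷ neg v ∷ [])
  SatClause-negPair⁺ notBoth with α u in αu | α v in αv
  ... | false | _     = here (Equivalence.from T-not-≡ αu)
  ... | true  | false = there (here (Equivalence.from T-not-≡ αv))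
  ... | true  | true  = ⊥-elim (notBoth refl refl)

  SatClause-negPair⁻ : SatClause α (neg u ∷ neg v ∷ []) → α u ≡ true → α v ≡ true → ⊥
  SatClause-negPair⁻ (here ¬αu)         αu αv = subst (T ∘ not) αu ¬αu
  SatClause-negPair⁻ (there (here ¬αv)) αu αv = subst (T ∘ not) αv ¬αv

module _ (G : Graph n) {α : Assignment n} where

  edgeClauses-sat⁺ : IsIndependent G α → ∀ u v → All (SatClause α) (edgeClauses G u v)
  edgeClauses-sat⁺ ind u v with adj G u v in uv
  ... | false = []
  ... | true  = SatClause-negPair⁺ (ind u v uv) ∷ []

  edgeClauses-sat⁻ : ∀ u v → All (SatClause α) (edgeClauses G u v) →
                     adj G u v ≡ true → α u ≡ true → α v ≡ true → ⊥
  edgeClauses-sat⁻ u v sat uv with adj G u v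
  edgeClauses-sat⁻ u v (sat ∷ []) uv | true = SatClause-negPair⁻ sat

  satisfies-φ⇔isIndependent : Satisfies α (φ G) ⇔ IsIndependent G α
  satisfies-φ⇔isIndependent = mk⇔
    (λ sat u v → edgeClauses-sat⁻ u v (All-concatMap-allFin⁻ (All-concatMap-allFin⁻ sat u) v))
    (λ ind → All-concatMap-allFin⁺ (λ u → All-concatMap-allFin⁺ (edgeClauses-sat⁺ ind u)))

∈-△⇒xor≡true : ∀ {α₁ α₂ : Assignment n} {u} → u ∈ α₁ △ α₂ → α₁ u xor α₂ u ≡ true
∈-△⇒xor≡true {α₁ = α₁} {α₂} {u} u∈ =
  trans (≡-sym (lookup∘tabulate (λ x → α₁ x xor α₂ x) u)) ([]=⇒lookup u∈)

IsProperColouringOn : Graph n → Subset n → (Fin n → Bool) → Set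
IsProperColouringOn G S c = ∀ u v → u ∈ S → v ∈ S → adj G u v ≡ true → c u ≢ c v

module _ (G : Graph n) {α₁ α₂ : Assignment n} where

  △-inducedBipartite : IsIndependent G α₁ → IsIndependent G α₂ → InducedBipartite G (α₁ △ α₂)
  △-inducedBipartite ind₁ ind₂ = α₁ , proper
    where
    inα₂ : ∀ {u} → u ∈ α₁ △ α₂ → α₁ u ≡ false → α₂ u ≡ true
    inα₂ {u} u∈ α₁u = subst (λ b → b xor α₂ u ≡ true) α₁u (∈-△⇒xor≡true {α₁ = α₁} {α₂} u∈)

    proper : IsProperColouringOn G (α₁ △ α₂) α₁
    proper u v u∈ v∈ uv with α₁ u in α₁u | α₁ v in α₁v
    ... | true  | true  = λ _ → ind₁ u v uv α₁u α₁v
    ... | false | false = λ _ → ind₂ u v uv (inα₂ u∈ α₁u) (inα₂ v∈ α₁v)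
    ... | true  | false = λ ()
    ... | false | true  = λ ()

colourClass : Subset n → (Fin n → Bool) → Assignment n
colourClass S c x = lookup S x ∧ c x

colourClasses-△ : ∀ (S : Subset n) c → colourClass S c △ colourClass S (not ∘ c) ≡ S
colourClasses-△ S c = trans (tabulate-cong (λ x → splitsAs (lookup S x) (c x))) (tabulate∘lookup S)
  where
  splitsAs : ∀ s b → (s ∧ b) xor (s ∧ not b) ≡ s
  splitsAs true  true  = refl
  splitsAs true  false = refl
  splitsAs false _     = refl

module _ (G : Graph n) (S : Subset n) where

  colourClass-isIndependent : ∀ {c} → IsProperColouringOn G S c → IsIndependent G (colourClass S c)
  colourClass-isIndependent proper u v uv inU inV =
    proper u v (lookup⇒[]= u S (∧-conicalˡ _ _ inU)) (lookup⇒[]= v S (∧-conicalˡ _ _ inV)) uv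
      (trans (∧-conicalʳ _ _ inU) (≡-sym (∧-conicalʳ _ _ inV)))

  not-isProperColouringOn : ∀ {c} → IsProperColouringOn G S c → IsProperColouringOn G S (not ∘ c)
  not-isProperColouringOn proper u v u∈ v∈ uv = proper u v u∈ v∈ uv ∘ not-injective

  inducedBipartite⇒independentPair : InducedBipartite G S →
    Σ[ α₁ ∈ Assignment n ] Σ[ α₂ ∈ Assignment n ]
      IsIndependent G α₁ × IsIndependent G α₂ × α₁ △ α₂ ≡ S
  inducedBipartite⇒independentPair (c , proper) =
    colourClass S c , colourClass S (not ∘ c) ,
    colourClass-isIndependent proper ,
    colourClass-isIndependent (not-isProperColouringOn proper) ,
    colourClasses-△ S c

lemma1 : ∀ {n : ℕ} (G : Graph n) (k : ℤ) →
    (Σ (Subset n) λ S → InducedBipartite G S × (k ≤ + ∣ S ∣))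
    ⇔ (Σ (Assignment n) λ α₁ → Σ (Assignment n) λ α₂ →
         Satisfies α₁ (φ G) × Satisfies α₂ (φ G) × (k ≤ + ∣ α₁ △ α₂ ∣))
lemma1 G k = mk⇔
  (λ (S , bipartite , k≤∣S∣) →
    let (α₁ , α₂ , ind₁ , ind₂ , α₁△α₂≡S) = inducedBipartite⇒independentPair G S bipartite
    in α₁ , α₂ , satisfies ind₁ , satisfies ind₂ ,
       subst (λ X → k ≤ + ∣ X ∣) (≡-sym α₁△α₂≡S) k≤∣S∣)
  (λ (α₁ , α₂ , sat₁ , sat₂ , k≤∣α₁△α₂∣) →
    α₁ △ α₂ , △-inducedBipartite G (independent sat₁) (independent sat₂) , k≤∣α₁△α₂∣)
  where
  satisfies : ∀ {α} → IsIndependent G α → Satisfies α (φ G)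
  satisfies = Equivalence.from (satisfies-φ⇔isIndependent G)

  independent : ∀ {α} → Satisfies α (φ G) → IsIndependent G α
  independent = Equivalence.to (satisfies-φ⇔isIndependent G)
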